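{- Let $G$ be a connected graph with a parallelogram placement $\rho$. Let $r$ be a ribbon of $G$ which is an edge cut and let $W$ be a walk in $G$. If $|r\cap W|$ is even, then $$\sum_{\overrightarrow{w_1w_2}\in r\cap W}\bigl(\rho(w_2)-\rho(w_1)\bigr)=0.$$
   Context: For a graph $G$, two edges are related if they are opposite edges of a 4-cycle subgraph of $G$; a ribbon is an equivalence class of the reflexive–transitive closure of this relation. A set of edges $r$ is an edge cut of a connected graph $G$ if $(V_G,E_G\setminus r)$ is disconnected. A parallelogram placement of a connected graph $G$ is an injective map $\rho:V_G\to\mathbb{R}^2$ such that every 4-cycle $(u_1,u_2,u_3,u_4)$ of $G$ forms a parallelogram, i.e. $\rho(u_2)-\rho(u_1)=\rho(u_3)-\rho(u_4)$. Notation: $\overrightarrow{w_1w_2}\in r\cap W$ means $w_1w_2\in r$ is an edge of $W$ traversed with $w_1$ preceding $w_2$; sums and the count $|r\cap W|$ are taken over the edges of $W$ as a multiset, each traversal counted with its direction. -}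

module Defs where

open import Level using (Level; _⊔_)
open import Data.Nat using (ℕ; zero; suc; _+_)
open import Data.Fin using (Fin)
open import Data.Bool using (Bool; true; false; if_then_else_)
open import Data.Product using (Σ; ∃; ∃-syntax; _×_; _,_)
open import Data.Sum using (_⊎_)
open import Relation.Nullary using (¬_)
open import Relation.Binary.PropositionalEquality using (_≡_)
open import Relation.Binary.Construct.Closure.ReflexiveTransitive using (Star; ε; _◅_)
open import Algebra.Bundles using (AbelianGroup)

record Graph : Set where
  field
    n      : ℕ
    adj    : Fin n → Fin n → Bool
    sym    : ∀ u v → adj u v ≡ adj v u
    irrefl : ∀ u → adj u u ≡ false

module _ (G : Graph) where
  open Graph G

  V : Set
  V = Fin n

  Adj : V → V → Set
  Adj u v = adj u v ≡ true

  Walk : V → V → Set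
  Walk = Star Adj

  Connected : Set
  Connected = ∀ x y → Walk x y

  -- edges of G as ordered representatives
  Edge : Set
  Edge = Σ V λ u → Σ V λ v → Adj u v

  SameEdge : Edge → Edge → Set
  SameEdge (u , v , _) (x , y , _) = (u ≡ x × v ≡ y) ⊎ (u ≡ y × v ≡ x)

  record FourCycle (a1 a2 a3 a4 : V) : Set where
    field
      e12 : Adj a1 a2
      e23 : Adj a2 a3
      e34 : Adj a3 a4
      e41 : Adj a4 a1
      d12 : ¬ a1 ≡ a2
      d13 : ¬ a1 ≡ a3
      d14 : ¬ a1 ≡ a4
      d23 : ¬ a2 ≡ a3
      d24 : ¬ a2 ≡ a4
      d34 : ¬ a3 ≡ a4

  Opposite : Edge → Edge → Set
  Opposite e f = ∃[ a1 ] ∃[ a2 ] ∃[ a3 ] ∃[ a4 ] Σ (FourCycle a1 a2 a3 a4) λ C →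
    SameEdge e (a1 , a2 , FourCycle.e12 C) × SameEdge f (a3 , a4 , FourCycle.e34 C)

  RibbonRel : Edge → Edge → Set
  RibbonRel = Star (λ e f → SameEdge e f ⊎ Opposite e f)

  -- an edge set, given by a Bool-valued predicate on ordered vertex pairs
  -- (membership of the unordered edge uv)
  EdgeSet : Set
  EdgeSet = V → V → Bool

  IsRibbon : EdgeSet → Set
  IsRibbon r = Σ Edge λ e0 →
    (∀ u v → r u v ≡ true → Adj u v) ×
    (∀ u v (a : Adj u v) → r u v ≡ true → RibbonRel e0 (u , v , a)) ×
    (∀ u v (a : Adj u v) → RibbonRel e0 (u , v , a) → r u v ≡ true)

  AdjMinus : EdgeSet → V → V → Set
  AdjMinus r u v = Adj u v × r u v ≡ false

  IsEdgeCut : EdgeSet → Set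
  IsEdgeCut r = ∃[ x ] ∃[ y ] ¬ Star (AdjMinus r) x y

  -- |r ∩ W|, counted with multiplicity over the edge traversals of W
  countIn : (r : EdgeSet) → ∀ {x y} → Walk x y → ℕ
  countIn r ε = 0
  countIn r (_◅_ {u} {v} _ w) = (if r u v then 1 else 0) + countIn r w

  module Plane {c ℓ : Level} (A : AbelianGroup c ℓ) where
    open AbelianGroup A renaming (ε to 0#)

    -- the plane A × A (the paper: ℝ × ℝ)
    Pt : Set c
    Pt = Carrier × Carrier

    _≈P_ : Pt → Pt → Set ℓ
    (a , b) ≈P (a' , b') = (a ≈ a') × (b ≈ b')

    _+P_ : Pt → Pt → Pt
    (a , b) +P (a' , b') = (a ∙ a' , b ∙ b')

    _-P_ : Pt → Pt → Pt
    (a , b) -P (a' , b') = (a ∙ a' ⁻¹ , b ∙ b' ⁻¹)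

    0P : Pt
    0P = (0# , 0#)

    IsParallelogramPlacement : (V → Pt) → Set ℓ
    IsParallelogramPlacement ρ =
      (∀ u v → ρ u ≈P ρ v → u ≡ v) ×
      (∀ u1 u2 u3 u4 → FourCycle u1 u2 u3 u4 → (ρ u2 -P ρ u1) ≈P (ρ u3 -P ρ u4))

    sumIn : (ρ : V → Pt) (r : EdgeSet) → ∀ {x y} → Walk x y → Pt
    sumIn ρ r ε = 0P
    sumIn ρ r (_◅_ {u} {v} _ w) = (if r u v then (ρ v -P ρ u) else 0P) +P sumIn ρ r w

{-# OPTIONS --safe #-}
module Submission where

open import Defs
open import Level using (Level)
open import Data.Nat.Divisibility using (_∣_)
open import Algebra.Bundles using (AbelianGroup)

open import Algebra.Construct.DirectProduct using (abelianGroup)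
import Algebra.Properties.AbelianGroup as AbelianGroupProperties
open import Data.Bool using (Bool; true; false; not; _xor_; if_then_else_)
open import Data.Bool.Properties using (not-involutive; not-¬; ¬-not)
open import Data.Empty using (⊥; ⊥-elim)
open import Data.Nat using (suc)
open import Data.Nat.Divisibility using (∣m+n∣m⇒∣n; ∣1⇒≡1; ∣-refl)
open import Data.Product using (_×_; _,_; proj₁; proj₂)
open import Data.Sum using (_⊎_; inj₁; inj₂; [_,_]′; swap)
import Data.Sum as Sum
open import Function using (id; const; _∘_)
open import Relation.Nullary using (¬_)
open import Relation.Binary.PropositionalEquality
  using (_≡_; refl; cong; cong₂; ≢-sym) renaming (sym to ≡-sym; trans to ≡-trans)
open import Relation.Binary.Construct.Closure.ReflexiveTransitive
  using (Star; ε; _◅_; _◅◅_; reverse)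

-- Propagating the parallelogram condition across 4-cycles, every edge of the
-- ribbon r of u0v0 has vector d = ρ(v0) − ρ(u0) in one orientation, so two
-- consecutive sides of a 4-cycle never both lie in r (ρ would not be injective).
-- Hence the sides joining two opposite r-edges avoid r, and every r-edge, oriented
-- with vector d, runs from the component of u0 in G − r to that of v0. These two
-- components cover G (connectedness) and are distinct (r is a cut). Giving the
-- v0-side potential d and the u0-side potential 0, every step of a walk contributes
-- the potential difference of its ends, so the sum telescopes; and each r-step
-- switches sides, so a walk with an even number of them ends on its starting side.

module _ (G : Graph) where

  Adj-sym : ∀ {u v} → Adj G u v → Adj G v u
  Adj-sym {u} {v} uv = ≡-trans (Graph.sym G v u) uv

  FourCycle-reflect : ∀ {a1 a2 a3 a4} → FourCycle G a1 a2 a3 a4 → FourCycle G a2 a1 a4 a3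
  FourCycle-reflect C = record
    { e12 = Adj-sym e12 ; e23 = Adj-sym e41 ; e34 = Adj-sym e34 ; e41 = Adj-sym e23
    ; d12 = ≢-sym d12 ; d13 = d24 ; d14 = d23 ; d23 = d14 ; d24 = d13 ; d34 = ≢-sym d34 }
    where open FourCycle C

  Unoriented : ∀ {p} → (V G → V G → Set p) → V G → V G → Set p
  Unoriented P u v = P u v ⊎ P v u

  OnEdge : ∀ {p} → (V G → V G → Set p) → Edge G → Set p
  OnEdge P (u , v , _) = P u v

  module _ {p} {P : V G → V G → Set p} where

    -- SameEdge is stated unfolded: in SameEdge G e f the adjacency proofs inside e
    -- and f would be uninferable.
    Unoriented-sameEdge : ∀ {u v x y} → (u ≡ x × v ≡ y) ⊎ (u ≡ y × v ≡ x) →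
      Unoriented P u v → Unoriented P x y
    Unoriented-sameEdge (inj₁ (refl , refl)) = id
    Unoriented-sameEdge (inj₂ (refl , refl)) = swap

    Unoriented-sameEdge⁻¹ : ∀ {u v x y} → (x ≡ u × y ≡ v) ⊎ (x ≡ v × y ≡ u) →
      Unoriented P u v → Unoriented P x y
    Unoriented-sameEdge⁻¹ (inj₁ (refl , refl)) = id
    Unoriented-sameEdge⁻¹ (inj₂ (refl , refl)) = swap

    module _ (P-opposite : ∀ {a1 a2 a3 a4} → FourCycle G a1 a2 a3 a4 → P a1 a2 → P a4 a3) where

      Unoriented-opposite : ∀ {a1 a2 a3 a4} → FourCycle G a1 a2 a3 a4 →
        Unoriented P a1 a2 → Unoriented P a3 a4
      Unoriented-opposite C (inj₁ p) = inj₂ (P-opposite C p)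
      Unoriented-opposite C (inj₂ p) = inj₁ (P-opposite (FourCycle-reflect C) p)

      ribbon-invariant : ∀ {e f} → RibbonRel G e f →
        OnEdge (Unoriented P) e → OnEdge (Unoriented P) f
      ribbon-invariant ε = id
      ribbon-invariant (inj₁ e≡f ◅ rel) = ribbon-invariant rel ∘ Unoriented-sameEdge e≡f
      ribbon-invariant (inj₂ (_ , _ , _ , _ , C , e≡a12 , f≡a34) ◅ rel) =
        ribbon-invariant rel ∘ Unoriented-sameEdge⁻¹ f≡a34
          ∘ Unoriented-opposite C ∘ Unoriented-sameEdge e≡a12

  module _ (r : EdgeSet G) (σ : V G → Bool)
           (σ-step : ∀ {u v} → Adj G u v → σ u ≡ r u v xor σ v) where

    countIn-even⇒same-σ : ∀ {x y} (W : Walk G x y) → 2 ∣ countIn G r W → σ x ≡ σ y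
    countIn-even⇒same-σ W = proj₁ (parity W)
      where
      parity : ∀ {x y} (W : Walk G x y) →
        (2 ∣ countIn G r W → σ x ≡ σ y) × (2 ∣ suc (countIn G r W) → σ x ≡ not (σ y))
      parity ε = (λ _ → refl) , λ 2∣1 → ⊥-elim (2≢1 (∣1⇒≡1 2∣1))
        where 2≢1 : ¬ 2 ≡ 1
              2≢1 ()
      parity (_◅_ {u} {v} uv W) with r u v | σ-step uv | parity W
      ... | false | σu≡σv | even , odd = ≡-trans σu≡σv ∘ even , ≡-trans σu≡σv ∘ odd
      ... | true  | σu≡¬σv | even , odd =
        (λ 2∣1+c → ≡-trans σu≡¬σv (≡-trans (cong not (odd 2∣1+c)) (not-involutive _))) ,
        (λ 2∣2+c → ≡-trans σu≡¬σv (cong not (even (∣m+n∣m⇒∣n 2∣2+c ∣-refl))))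

module _ {c ℓ} (A : AbelianGroup c ℓ) (G : Graph) where
  open Plane G A
  -- Pt with _≈P_, _+P_, _-P_ and 0P is definitionally the direct product group A × A.
  open AbelianGroup (abelianGroup A A)
    using (_∙_; _⁻¹; assoc; comm; ∙-cong; ∙-congˡ; inverseʳ; sym; setoid)
  open AbelianGroupProperties (abelianGroup A A) using (\\-leftDividesʳ)
  open import Relation.Binary.Reasoning.Setoid setoid

  sumIn-telescopes : (ρ : V G → Pt) (r : EdgeSet G) (φ : V G → Pt) →
    (∀ {u v} → Adj G u v → (if r u v then ρ v -P ρ u else 0P) ≈P (φ v -P φ u)) →
    ∀ {x y} (W : Walk G x y) → sumIn ρ r W ≈P (φ y -P φ x)
  sumIn-telescopes ρ r φ step {x} ε = sym (inverseʳ (φ x))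
  sumIn-telescopes ρ r φ step (_◅_ {u} {v} {y} uv W) = begin
    (if r u v then ρ v -P ρ u else 0P) +P sumIn ρ r W
      ≈⟨ ∙-cong (step uv) (sumIn-telescopes ρ r φ step W) ⟩
    (φ v -P φ u) +P (φ y -P φ v)   ≈⟨ comm _ _ ⟩
    (φ y -P φ v) +P (φ v -P φ u)   ≈⟨ assoc _ _ _ ⟩
    φ y ∙ (φ v ⁻¹ ∙ (φ v -P φ u))  ≈⟨ ∙-congˡ (\\-leftDividesʳ (φ v) (φ u ⁻¹)) ⟩
    φ y -P φ u                     ∎

module Placement {b ℓ} (B : AbelianGroup b ℓ) (G : Graph) where
  open AbelianGroup B renaming (ε to 0#; refl to ≈-refl)
  open AbelianGroupProperties B
    using (∙-cancelˡ; ∙-cancelʳ; ⁻¹-injective; ⁻¹-anti-homo‿-; ε⁻¹≈ε; x≈y⇒x∙y⁻¹≈ε)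
  open import Relation.Binary.Reasoning.Setoid setoid

  module Parallelogram (ρ : V G → Carrier)
    (ρ-injective : ∀ u v → ρ u ≈ ρ v → u ≡ v)
    (ρ-parallelogram : ∀ u1 u2 u3 u4 → FourCycle G u1 u2 u3 u4 →
                       ρ u2 - ρ u1 ≈ ρ u3 - ρ u4) where

    vec : V G → V G → Carrier
    vec u v = ρ v - ρ u

    vec-cancelˡ : ∀ {u v w} → vec u v ≈ vec u w → v ≡ w
    vec-cancelˡ {u} {v} {w} eq = ρ-injective v w (∙-cancelʳ (ρ u ⁻¹) (ρ v) (ρ w) eq)

    vec-cancelʳ : ∀ {u v w} → vec u w ≈ vec v w → u ≡ v
    vec-cancelʳ {u} {v} {w} eq =
      ρ-injective u v (⁻¹-injective (∙-cancelˡ (ρ w) (ρ u ⁻¹) (ρ v ⁻¹) eq))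

    HasVector : Carrier → V G → V G → Set ℓ
    HasVector d u v = vec u v ≈ d

    HasVector-opposite : ∀ {d a1 a2 a3 a4} → FourCycle G a1 a2 a3 a4 →
      HasVector d a1 a2 → HasVector d a4 a3
    HasVector-opposite {a1 = a1} {a2} {a3} {a4} C = trans (sym (ρ-parallelogram a1 a2 a3 a4 C))

    consecutive-sides-±-⊥ : ∀ {d a1 a2 a3 a4} → FourCycle G a1 a2 a3 a4 →
      Unoriented G (HasVector d) a1 a2 → Unoriented G (HasVector d) a2 a3 → ⊥
    consecutive-sides-±-⊥ C (inj₁ p) (inj₁ q) =
      FourCycle.d24 C (≡-sym (vec-cancelʳ (trans (HasVector-opposite C p) (sym q))))
    consecutive-sides-±-⊥ C (inj₂ p) (inj₂ q) =
      FourCycle.d24 C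
        (≡-sym (vec-cancelˡ (trans (HasVector-opposite (FourCycle-reflect G C) p) (sym q))))
    consecutive-sides-±-⊥ C (inj₁ p) (inj₂ q) = FourCycle.d13 C (vec-cancelʳ (trans p (sym q)))
    consecutive-sides-±-⊥ C (inj₂ p) (inj₁ q) = FourCycle.d13 C (vec-cancelˡ (trans p (sym q)))

    module RibbonCut (r : EdgeSet G) (ribbon : IsRibbon G r)
      (connected : Connected G) (cut : IsEdgeCut G r) where

      u0 v0 : V G
      u0 = proj₁ (proj₁ ribbon)
      v0 = proj₁ (proj₂ (proj₁ ribbon))

      d : Carrier
      d = vec u0 v0

      r⊆E : ∀ u v → r u v ≡ true → Adj G u v
      r⊆E = proj₁ (proj₂ ribbon)

      r⊆ribbon : ∀ u v (uv : Adj G u v) → r u v ≡ true → RibbonRel G (proj₁ ribbon) (u , v , uv)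
      r⊆ribbon = proj₁ (proj₂ (proj₂ ribbon))

      ribbon⊆r : ∀ u v (uv : Adj G u v) → RibbonRel G (proj₁ ribbon) (u , v , uv) → r u v ≡ true
      ribbon⊆r = proj₂ (proj₂ (proj₂ ribbon))

      r-sym : ∀ {u v} → r u v ≡ true → r v u ≡ true
      r-sym {u} {v} uv∈r = ribbon⊆r v u (Adj-sym G uv)
        (r⊆ribbon u v uv uv∈r ◅◅ inj₁ (inj₂ (refl , refl)) ◅ ε)
        where uv = r⊆E u v uv∈r

      r-invariant : ∀ {p} {P : V G → V G → Set p} →
        (∀ {a1 a2 a3 a4} → FourCycle G a1 a2 a3 a4 → P a1 a2 → P a4 a3) →
        P u0 v0 → ∀ {u v} → r u v ≡ true → Unoriented G P u v
      r-invariant P-opposite base {u} {v} uv∈r =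
        ribbon-invariant G P-opposite (r⊆ribbon u v (r⊆E u v uv∈r) uv∈r) (inj₁ base)

      Reach : V G → V G → Set
      Reach = Star (AdjMinus G r)

      Reach-reverse : ∀ {u v} → Reach u v → Reach v u
      Reach-reverse = reverse λ (uv , uv∉r) → Adj-sym G uv , ¬-not (not-¬ uv∉r ∘ r-sym)

      r-±d : ∀ {u v} → r u v ≡ true → Unoriented G (HasVector d) u v
      r-±d = r-invariant HasVector-opposite ≈-refl

      next-side-avoids-r : ∀ {a1 a2 a3 a4} → FourCycle G a1 a2 a3 a4 →
        Unoriented G (HasVector d) a1 a2 → AdjMinus G r a2 a3
      next-side-avoids-r C a12 =
        FourCycle.e23 C , ¬-not (λ a23∈r → consecutive-sides-±-⊥ C a12 (r-±d a23∈r))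

      Crossing : V G → V G → Set ℓ
      Crossing u v = Reach u0 u × Reach v0 v × HasVector d u v

      Crossing-opposite : ∀ {a1 a2 a3 a4} → FourCycle G a1 a2 a3 a4 →
        Crossing a1 a2 → Crossing a4 a3
      Crossing-opposite C (u0⇝a1 , v0⇝a2 , a12) =
        u0⇝a1 ◅◅ next-side-avoids-r (FourCycle-reflect G C) (inj₂ a12) ◅ ε ,
        v0⇝a2 ◅◅ next-side-avoids-r C (inj₁ a12) ◅ ε ,
        HasVector-opposite C a12

      r-crossing : ∀ {u v} → r u v ≡ true → Unoriented G Crossing u v
      r-crossing = r-invariant Crossing-opposite (ε , ε , ≈-refl)

      Side : V G → Set
      Side z = Reach u0 z ⊎ Reach v0 z

      crossing-side : ∀ {u v} → Unoriented G Crossing u v → Side v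
      crossing-side (inj₁ (_ , v0⇝v , _)) = inj₂ v0⇝v
      crossing-side (inj₂ (u0⇝v , _ , _)) = inj₁ u0⇝v

      Side-along : ∀ {x y} → Walk G x y → Side x → Side y
      Side-along ε = id
      Side-along (_◅_ {u} {v} uv W) with r u v in uv∈r
      ... | true  = λ _ → Side-along W (crossing-side (r-crossing uv∈r))
      ... | false = Side-along W ∘ Sum.map extend extend
        where
        extend : ∀ {w} → Reach w u → Reach w v
        extend w⇝u = w⇝u ◅◅ (uv , uv∈r) ◅ ε

      side : ∀ z → Side z
      side z = Side-along (connected u0 z) (inj₁ ε)

      u0-v0-separated : ¬ Reach u0 v0
      u0-v0-separated u0⇝v0 =
        let x , y , x↮y = cut in x↮y (Reach-reverse (u0⇝ x) ◅◅ u0⇝ y)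
        where
        u0⇝ : ∀ z → Reach u0 z
        u0⇝ z = [ id , u0⇝v0 ◅◅_ ]′ (side z)

      onV0Side : V G → Bool
      onV0Side z = [ const false , const true ]′ (side z)

      onV0Side-u0 : ∀ {z} → Reach u0 z → onV0Side z ≡ false
      onV0Side-u0 {z} u0⇝z with side z
      ... | inj₁ _    = refl
      ... | inj₂ v0⇝z = ⊥-elim (u0-v0-separated (u0⇝z ◅◅ Reach-reverse v0⇝z))

      onV0Side-v0 : ∀ {z} → Reach v0 z → onV0Side z ≡ true
      onV0Side-v0 {z} v0⇝z with side z
      ... | inj₁ u0⇝z = ⊥-elim (u0-v0-separated (u0⇝z ◅◅ Reach-reverse v0⇝z))
      ... | inj₂ _    = refl

      onV0Side-reach : ∀ {u v} → Reach u v → onV0Side u ≡ onV0Side v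
      onV0Side-reach {u} u⇝v =
        [ (λ u0⇝u → ≡-trans (onV0Side-u0 u0⇝u) (≡-sym (onV0Side-u0 (u0⇝u ◅◅ u⇝v))))
        , (λ v0⇝u → ≡-trans (onV0Side-v0 v0⇝u) (≡-sym (onV0Side-v0 (v0⇝u ◅◅ u⇝v))))
        ]′ (side u)

      onV0Side-step : ∀ {u v} → Adj G u v → onV0Side u ≡ r u v xor onV0Side v
      onV0Side-step {u} {v} uv with r u v in uv∈r
      ... | false = onV0Side-reach ((uv , uv∈r) ◅ ε)
      ... | true with r-crossing uv∈r
      ...   | inj₁ (u0⇝u , v0⇝v , _) =
        ≡-trans (onV0Side-u0 u0⇝u) (cong not (≡-sym (onV0Side-v0 v0⇝v)))
      ...   | inj₂ (u0⇝v , v0⇝u , _) =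
        ≡-trans (onV0Side-v0 v0⇝u) (cong not (≡-sym (onV0Side-u0 u0⇝v)))

      level : Bool → Carrier
      level b = if b then d else 0#

      potential : V G → Carrier
      potential = level ∘ onV0Side

      potential-u0 : ∀ {z} → Reach u0 z → potential z ≡ 0#
      potential-u0 = cong level ∘ onV0Side-u0

      potential-v0 : ∀ {z} → Reach v0 z → potential z ≡ d
      potential-v0 = cong level ∘ onV0Side-v0

      potential-step : ∀ {u v} → Adj G u v →
        (if r u v then vec u v else 0#) ≈ potential v - potential u
      potential-step {u} {v} uv with r u v in uv∈r
      ... | false = sym (x≈y⇒x∙y⁻¹≈ε (reflexive (cong level (≡-sym (onV0Side-reach u⇝v)))))
        where u⇝v = (uv , uv∈r) ◅ ε
      ... | true with r-crossing uv∈r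
      ...   | inj₁ (u0⇝u , v0⇝v , uv≈d) = begin
        vec u v                    ≈⟨ uv≈d ⟩
        d                          ≈⟨ identityʳ d ⟨
        d ∙ 0#                     ≈⟨ ∙-congˡ ε⁻¹≈ε ⟨
        d - 0#                     ≡⟨ cong₂ _-_ (potential-v0 v0⇝v) (potential-u0 u0⇝u) ⟨
        potential v - potential u  ∎
      ...   | inj₂ (u0⇝v , v0⇝u , vu≈d) = begin
        vec u v                    ≈⟨ ⁻¹-anti-homo‿- (ρ u) (ρ v) ⟨
        vec v u ⁻¹                 ≈⟨ ⁻¹-cong vu≈d ⟩
        d ⁻¹                       ≈⟨ identityˡ (d ⁻¹) ⟨
        0# - d                     ≡⟨ cong₂ _-_ (potential-u0 u0⇝v) (potential-v0 v0⇝u) ⟨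
        potential v - potential u  ∎

lemma3p7 : ∀ {c ℓ : Level} (A : AbelianGroup c ℓ) (G : Graph) → Connected G →
    (ρ : V G → Plane.Pt G A) → Plane.IsParallelogramPlacement G A ρ →
    (r : EdgeSet G) → IsRibbon G r → IsEdgeCut G r →
    ∀ {x y} (W : Walk G x y) → 2 ∣ countIn G r W →
    Plane._≈P_ G A (Plane.sumIn G A ρ r W) (Plane.0P G A)
lemma3p7 A G connected ρ (ρ-injective , ρ-parallelogram) r ribbon cut {x} {y} W even = begin
    sumIn ρ r W                ≈⟨ sumIn-telescopes A G ρ r potential potential-step W ⟩
    potential y - potential x  ≈⟨ x≈y⇒x∙y⁻¹≈ε (reflexive (cong level y≡x)) ⟩
    0P                         ∎
  where
  open Plane G A
  open AbelianGroup (abelianGroup A A) using (_-_; reflexive; setoid)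
  open AbelianGroupProperties (abelianGroup A A) using (x≈y⇒x∙y⁻¹≈ε)
  open import Relation.Binary.Reasoning.Setoid setoid
  open Placement.Parallelogram (abelianGroup A A) G ρ ρ-injective ρ-parallelogram
  open RibbonCut r ribbon connected cut
  y≡x : onV0Side y ≡ onV0Side x
  y≡x = ≡-sym (countIn-even⇒same-σ G r onV0Side onV0Side-step W even)
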